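{- Let $p$ be an odd prime and $n$ a nonnegative integer with $2n<p-5$. Then $$p\Big(\mathcal{H}_{2(p-1)-2n}-\mathcal{H}_{p-1-2n}\Big)\equiv 1+\frac{p}{2n+1}\pmod{p^2}.$$
   Context: $\mathcal{H}_m=1+\frac12+\dots+\frac1m$ denotes the $m$-th harmonic number. Congruences are in $\mathbb{Z}_p$: $x\equiv y\pmod{p^k}$ means $x-y\in p^k\mathbb{Z}_p$. -}

module Defs where

open import Data.Nat using (ℕ; zero; suc; _^_)
open import Data.Nat.Divisibility using (_∣_)
open import Data.Integer using (+_; ∣_∣)
open import Data.Rational using (ℚ; _/_; _+_; _-_; ↥_; 0ℚ)

H : ℕ → ℚ
H zero    = 0ℚ
H (suc m) = H m + (+ 1 / suc m)

-- Congruence in ℤ_p:  x ≡ y (mod p^k)  iff  x - y ∈ p^k ℤ_p.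
-- Since ℚ values are stored in lowest terms, for prime p this holds iff
-- p^k divides the (reduced) numerator of x - y: indeed if p ∣ numerator
-- then p ∤ denominator, so v_p(x - y) = v_p(numerator).
_≡_[mod_^_] : ℚ → ℚ → ℕ → ℕ → Set
x ≡ y [mod p ^ k ] = (p ^ k) ∣ ∣ ↥ (x - y) ∣

module Submission where

-- With m = 2n and c = p − 2 − m, the left side minus the right side is p·X, where
-- X = (H(p+c) − H p − H c) + H(p−1) − (1/(c+1) + 1/(m+1)), since H p = H(p−1) + 1/p.
-- Each summand of X lies in pℤ₍ₚ₎: the first because 1/(p+i) ≡ 1/i, the second by
-- pairing 1/i with 1/(p−i) (p odd), the third because (c+1) + (m+1) = p.

open import Defs
open import Data.Nat using (ℕ; suc; _*_; _∸_; _+_; _<_)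
open import Data.Nat.Primality using (Prime)
open import Data.Integer using (+_)
open import Data.Rational using (ℚ; _/_; 1ℚ)
open import Data.Rational as Q using ()
open import Relation.Binary.PropositionalEquality using (_≢_)

open import Data.Nat using (zero; _^_; _≤_; s≤s; z≤n; nonTrivial⇒n>1)
import Data.Nat.Properties as ℕ
open import Data.Nat.Divisibility using (_∣_; divides; _∣0; 1∣_; ∣-trans; m∣m*n; *-pres-∣; *-monoʳ-∣; *-cancelˡ-∣; >⇒∤; ∣-reflexive; ∣-refl; ∣m+n∣m⇒∣n)
open import Data.Nat.Primality using (euclidsLemma; prime⇒nonZero; prime⇒nonTrivial)
open import Data.Integer as ℤ using (ℤ; ∣_∣)
import Data.Integer.Properties as ℤ
open import Data.Integer.Divisibility.Signed using (∣ᵤ⇒∣; ∣⇒∣ᵤ; ∣m∣n⇒∣m+n; ∣m⇒∣m*n)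
open import Data.Rational.Properties as Q using (toℚᵘ-homo-+; toℚᵘ-homo-*; toℚᵘ-homo‿-; toℚᵘ-fromℚᵘ)
open import Data.Rational.Unnormalised as ℚᵘ using (ℚᵘ; mkℚᵘ; _≃_; *≡*)
import Data.Rational.Unnormalised.Properties as ℚᵘ
open import Data.Empty using (⊥-elim)
open import Data.Sum using (inj₁; inj₂)
open import Relation.Nullary using (¬_)
open import Relation.Binary.PropositionalEquality
open import Relation.Nullary.Decidable using (dec⇒maybe)
open import Tactic.RingSolver.Core.AlmostCommutativeRing using (AlmostCommutativeRing; fromCommutativeRing)
open import Tactic.RingSolver using (solve-∀)
open import Data.Integer.Tactic.RingSolver using () renaming (ring to ℤ-ring)
open import Data.Nat.Tactic.RingSolver using () renaming (ring to ℕ-ring)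

ℚ-ring : AlmostCommutativeRing _ _
ℚ-ring = fromCommutativeRing Q.+-*-commutativeRing (λ x → dec⇒maybe (Q.0ℚ Q.≟ x))

n/1*1/d≡n/d : ∀ n d → (+ n / 1) Q.* (+ 1 / suc d) ≡ + n / suc d
n/1*1/d≡n/d n d = Q.toℚᵘ-injective
  (ℚᵘ.≃-trans (toℚᵘ-homo-* (+ n / 1) (+ 1 / suc d))
  (ℚᵘ.≃-trans (ℚᵘ.*-cong (toℚᵘ-fromℚᵘ (mkℚᵘ (+ n) 0)) (toℚᵘ-fromℚᵘ (mkℚᵘ (+ 1) d)))
  (ℚᵘ.≃-trans (*≡* (ℤ.*-assoc (+ n) (+ 1) (+ suc d))) (ℚᵘ.≃-sym (toℚᵘ-fromℚᵘ (mkℚᵘ (+ n) d))))))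

n/n≡1 : ∀ n → + suc n / suc n ≡ 1ℚ
n/n≡1 n = Q.fromℚᵘ-cong {mkℚᵘ (+ suc n) n} {ℚᵘ.1ℚᵘ} (*≡* (ℤ.*-comm (+ suc n) (+ 1)))

module Valuation {p : ℕ} (p-prime : Prime p) where

  private instance
    p-nonZero = prime⇒nonZero p-prime
    p-nonTrivial = prime⇒nonTrivial p-prime

  ∤-* : ∀ {m n} → ¬ p ∣ m → ¬ p ∣ n → ¬ p ∣ m * n
  ∤-* {m} {n} p∤m p∤n p∣mn with euclidsLemma m n p-prime p∣mn
  ... | inj₁ p∣m = p∤m p∣m
  ... | inj₂ p∣n = p∤n p∣n

  ^∣*∤⇒^∣ : ∀ k {m n} → ¬ p ∣ n → p ^ k ∣ m * n → p ^ k ∣ m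
  ^∣*∤⇒^∣ zero    _   _ = 1∣ _
  ^∣*∤⇒^∣ (suc k) {m} {n} p∤n pᵏ⁺¹∣mn with euclidsLemma m n p-prime (∣-trans (m∣m*n (p ^ k)) pᵏ⁺¹∣mn)
  ... | inj₂ p∣n = ⊥-elim (p∤n p∣n)
  ... | inj₁ (divides m′ refl) = subst (p ^ suc k ∣_) (ℕ.*-comm p m′) (*-monoʳ-∣ p pᵏ∣m′)
    where
    pᵏ∣m′ : p ^ k ∣ m′
    pᵏ∣m′ = ^∣*∤⇒^∣ k p∤n (*-cancelˡ-∣ p (subst (p ^ suc k ∣_)
      (trans (cong (_* n) (ℕ.*-comm m′ p)) (ℕ.*-assoc p m′ n)) pᵏ⁺¹∣mn))

  ∣-linear : ∀ {m} i j u v → m ∣ ∣ i ∣ → m ∣ ∣ j ∣ → m ∣ ∣ i ℤ.* u ℤ.+ j ℤ.* v ∣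
  ∣-linear {m} i j u v m∣i m∣j =
    ∣⇒∣ᵤ {+ m} (∣m∣n⇒∣m+n (∣m⇒∣m*n u (∣ᵤ⇒∣ {+ m} {i} m∣i)) (∣m⇒∣m*n v (∣ᵤ⇒∣ {+ m} {j} m∣j)))

  -- k ≤v x says v_p(x) ≥ k, i.e. x ∈ p^k ℤ₍ₚ₎.
  infix 4 _≤v_
  record _≤v_ (k : ℕ) (x : ℚ) : Set where
    constructor represented
    field
      representative      : ℚᵘ
      toℚᵘ≃representative : Q.toℚᵘ x ≃ representative
      p∤denominator       : ¬ p ∣ ℚᵘ.↧ₙ representative
      pᵏ∣numerator        : p ^ k ∣ ∣ ℚᵘ.↥ representative ∣

  p∤1 : ¬ p ∣ 1
  p∤1 = >⇒∤ (nonTrivial⇒n>1 p)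

  ≤v-0 : ∀ k → k ≤v Q.0ℚ
  ≤v-0 k = represented ℚᵘ.0ℚᵘ ℚᵘ.≃-refl p∤1 ((p ^ k) ∣0)

  ≤v-/ : ∀ {k} i d → ¬ p ∣ suc d → p ^ k ∣ ∣ i ∣ → k ≤v i / suc d
  ≤v-/ i d p∤d pᵏ∣i = represented (mkℚᵘ i d) (toℚᵘ-fromℚᵘ (mkℚᵘ i d)) p∤d pᵏ∣i

  ≤v-/+/ : ∀ {k} i j m n → ¬ p ∣ suc m → ¬ p ∣ suc n →
           p ^ k ∣ ∣ i ℤ.* + suc n ℤ.+ j ℤ.* + suc m ∣ → k ≤v i / suc m Q.+ j / suc n
  ≤v-/+/ i j m n p∤m p∤n pᵏ∣numerator =
    represented (mkℚᵘ i m ℚᵘ.+ mkℚᵘ j n)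
      (ℚᵘ.≃-trans (toℚᵘ-homo-+ (i / suc m) (j / suc n))
                  (ℚᵘ.+-cong (toℚᵘ-fromℚᵘ (mkℚᵘ i m)) (toℚᵘ-fromℚᵘ (mkℚᵘ j n))))
      (∤-* p∤m p∤n) pᵏ∣numerator

  ≤v-+ : ∀ {k x y} → k ≤v x → k ≤v y → k ≤v x Q.+ y
  ≤v-+ {k} {x} {y} (represented (mkℚᵘ a d) x≃ p∤d pᵏ∣a) (represented (mkℚᵘ b e) y≃ p∤e pᵏ∣b) =
    represented (mkℚᵘ a d ℚᵘ.+ mkℚᵘ b e)
      (ℚᵘ.≃-trans (toℚᵘ-homo-+ x y) (ℚᵘ.+-cong x≃ y≃))
      (∤-* p∤d p∤e)
      (∣-linear a b _ _ pᵏ∣a pᵏ∣b)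

  ≤v-neg : ∀ {k x} → k ≤v x → k ≤v Q.- x
  ≤v-neg {k} {x} (represented (mkℚᵘ a d) x≃ p∤d pᵏ∣a) =
    represented (ℚᵘ.- mkℚᵘ a d) (ℚᵘ.≃-trans (toℚᵘ-homo‿- x) (ℚᵘ.-‿cong x≃)) p∤d
      (subst (p ^ k ∣_) (sym (ℤ.∣-i∣≡∣i∣ a)) pᵏ∣a)

  ≤v-- : ∀ {k x y} → k ≤v x → k ≤v y → k ≤v x Q.- y
  ≤v-- x≤ y≤ = ≤v-+ x≤ (≤v-neg y≤)

  ≤v-* : ∀ {j k x y} → j ≤v x → k ≤v y → j + k ≤v x Q.* y
  ≤v-* {j} {k} {x} {y} (represented (mkℚᵘ a d) x≃ p∤d pʲ∣a) (represented (mkℚᵘ b e) y≃ p∤e pᵏ∣b) =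
    represented (mkℚᵘ a d ℚᵘ.* mkℚᵘ b e)
      (ℚᵘ.≃-trans (toℚᵘ-homo-* x y) (ℚᵘ.*-cong x≃ y≃))
      (∤-* p∤d p∤e)
      (subst₂ _∣_ (sym (ℕ.^-distribˡ-+-* p j k)) (sym (ℤ.abs-* a b)) (*-pres-∣ pʲ∣a pᵏ∣b))

  ≤v⇒∣↥ : ∀ {k x} → k ≤v x → p ^ k ∣ ∣ Q.↥ x ∣
  ≤v⇒∣↥ {k} {Q.mkℚ a d _} (represented (mkℚᵘ b e) (*≡* a*e≡b*d) p∤e pᵏ∣b) =
    ^∣*∤⇒^∣ k p∤e (subst (p ^ k ∣_) ∣b∣*d≡∣a∣*e (∣-trans pᵏ∣b (m∣m*n (suc d))))
    where
    ∣b∣*d≡∣a∣*e : ∣ b ∣ * suc d ≡ ∣ a ∣ * suc e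
    ∣b∣*d≡∣a∣*e = trans (sym (ℤ.abs-* b (+ suc d)))
                  (trans (cong ∣_∣ (sym a*e≡b*d)) (ℤ.abs-* a (+ suc e)))

module Harmonic {q : ℕ} (p-prime : Prime (suc q)) where
  open Valuation p-prime

  private
    p : ℕ
    p = suc q

  reciprocal-pair : ∀ m n → suc m + suc n ≡ p → 1 ≤v + 1 / suc m Q.+ + 1 / suc n
  reciprocal-pair m n m+n≡p = ≤v-/+/ (+ 1) (+ 1) m n (>⇒∤ m<p) (>⇒∤ n<p) (∣-reflexive numerator≡p)
    where
    m<p : suc m < p
    m<p = subst (suc m <_) m+n≡p (ℕ.m<m+n (suc m) (s≤s z≤n))
    n<p : suc n < p
    n<p = subst (suc n <_) m+n≡p (ℕ.m<n+m (suc n) (s≤s z≤n))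
    numerator≡p : p * 1 ≡ ∣ + 1 ℤ.* + suc n ℤ.+ + 1 ℤ.* + suc m ∣
    numerator≡p = begin
      p * 1                                     ≡⟨ ℕ.*-identityʳ p ⟩
      p                                         ≡⟨ sym m+n≡p ⟩
      suc m + suc n                             ≡⟨ ℕ.+-comm (suc m) (suc n) ⟩
      ∣ + suc n ℤ.+ + suc m ∣                   ≡⟨ cong ∣_∣ (sum (+ suc n) (+ suc m)) ⟩
      ∣ + 1 ℤ.* + suc n ℤ.+ + 1 ℤ.* + suc m ∣   ∎
      where
      open ≡-Reasoning
      sum : ∀ a b → a ℤ.+ b ≡ + 1 ℤ.* a ℤ.+ + 1 ℤ.* b
      sum = solve-∀ ℤ-ring

  reciprocal-shift : ∀ m → suc m < p → 1 ≤v + 1 / suc (p + m) Q.- + 1 / suc m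
  reciprocal-shift m m<p = ≤v-/+/ (+ 1) (ℤ.- + 1) (p + m) m p∤p+m (>⇒∤ m<p) (∣-reflexive numerator≡p)
    where
    p∤p+m : ¬ p ∣ suc (p + m)
    p∤p+m p∣p+m = >⇒∤ m<p (∣m+n∣m⇒∣n (subst (p ∣_) (sym (ℕ.+-suc p m)) p∣p+m) ∣-refl)
    numerator≡p : p * 1 ≡ ∣ + 1 ℤ.* + suc m ℤ.+ ℤ.- + 1 ℤ.* + suc (p + m) ∣
    numerator≡p = begin
      p * 1                                                  ≡⟨ ℕ.*-identityʳ p ⟩
      ∣ ℤ.- + p ∣                                            ≡⟨ cong ∣_∣ (shift (+ p) (+ suc m)) ⟩
      ∣ + 1 ℤ.* + suc m ℤ.+ ℤ.- + 1 ℤ.* (+ p ℤ.+ + suc m) ∣  ≡⟨ cong (λ i → ∣ + 1 ℤ.* + suc m ℤ.+ ℤ.- + 1 ℤ.* i ∣) p+[m+1]≡1+p+m ⟩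
      ∣ + 1 ℤ.* + suc m ℤ.+ ℤ.- + 1 ℤ.* + suc (p + m) ∣      ∎
      where
      open ≡-Reasoning
      shift : ∀ a b → ℤ.- a ≡ + 1 ℤ.* b ℤ.+ ℤ.- + 1 ℤ.* (a ℤ.+ b)
      shift = solve-∀ ℤ-ring
      p+[m+1]≡1+p+m : + p ℤ.+ + suc m ≡ + suc (p + m)
      p+[m+1]≡1+p+m = trans (sym (ℤ.pos-+ p (suc m))) (cong +_ (ℕ.+-suc p m))

  H-reflection : ∀ j a → a + j ≡ q → 1 ≤v H j Q.+ (H q Q.- H a)
  H-reflection zero a a+0≡q =
    subst (λ b → 1 ≤v H 0 Q.+ (H q Q.- H b)) (trans (sym a+0≡q) (ℕ.+-identityʳ a))
      (subst (1 ≤v_) (cancel (H q)) (≤v-0 1))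
    where
    cancel : ∀ x → Q.0ℚ ≡ Q.0ℚ Q.+ (x Q.- x)
    cancel = solve-∀ ℚ-ring
  H-reflection (suc j) a a+j+1≡q =
    subst (1 ≤v_) (regroup (H j) (H q) (H a) (+ 1 / suc j) (+ 1 / suc a))
      (≤v-+ (H-reflection j (suc a) a+1+j≡q)
            (reciprocal-pair j a (cong suc (trans (ℕ.+-comm j (suc a)) a+1+j≡q))))
    where
    a+1+j≡q : suc a + j ≡ q
    a+1+j≡q = trans (sym (ℕ.+-suc a j)) a+j+1≡q
    regroup : ∀ hj hq ha x y → (hj Q.+ (hq Q.- (ha Q.+ y))) Q.+ (x Q.+ y) ≡ (hj Q.+ x) Q.+ (hq Q.- ha)
    regroup = solve-∀ ℚ-ring

  H[p∸1]-divisible : 2 < p → 1 ≤v H q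
  H[p∸1]-divisible 2<p =
    subst (1 ≤v_) (trans (double (+ 1 / 2) (H q)) (Q.*-identityˡ (H q)))
      (≤v-* (≤v-/ {0} (+ 1) 1 (>⇒∤ 2<p) (1∣ 1)) (H-reflection q 0 refl))
    where
    double : ∀ h x → h Q.* (x Q.+ (x Q.- Q.0ℚ)) ≡ (h Q.+ h) Q.* x
    double = solve-∀ ℚ-ring

  H-shift : ∀ c → c < p → 1 ≤v H (p + c) Q.- H p Q.- H c
  H-shift zero _ =
    subst (λ n → 1 ≤v H n Q.- H p Q.- H 0) (sym (ℕ.+-identityʳ p))
      (subst (1 ≤v_) (cancel (H p)) (≤v-0 1))
    where
    cancel : ∀ x → Q.0ℚ ≡ x Q.- x Q.- Q.0ℚ
    cancel = solve-∀ ℚ-ring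
  H-shift (suc c) c+1<p =
    subst (λ n → 1 ≤v H n Q.- H p Q.- H (suc c)) (sym (ℕ.+-suc p c))
      (subst (1 ≤v_) (regroup (H (p + c)) (H p) (H c) (+ 1 / suc (p + c)) (+ 1 / suc c))
        (≤v-+ (H-shift c (ℕ.<-trans (ℕ.n<1+n c) c+1<p)) (reciprocal-shift c c+1<p)))
    where
    regroup : ∀ a b h u v → (a Q.- b Q.- h) Q.+ (u Q.- v) ≡ (a Q.+ u) Q.- b Q.- (h Q.+ v)
    regroup = solve-∀ ℚ-ring

  harmonic-difference-congruence : 2 < p → ∀ m c → suc (m + c) ≡ q →
    2 ≤v (+ p / 1) Q.* (H (p + c) Q.- H (suc c)) Q.- (1ℚ Q.+ + p / suc m)
  harmonic-difference-congruence 2<p m c m+c+1≡q = subst (2 ≤v_) (sym expand) (≤v-* {1} p-divisible X-divisible)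
    where
    pℚ : ℚ
    pℚ = + p / 1
    X : ℚ
    X = (H (p + c) Q.- H p Q.- H c) Q.+ H q Q.- (+ 1 / suc c Q.+ + 1 / suc m)
    c<p : c < p
    c<p = ℕ.<-trans (s≤s (ℕ.m≤n+m c m)) (subst (_< p) (sym m+c+1≡q) (ℕ.n<1+n q))
    c+m+2≡p : suc c + suc m ≡ p
    c+m+2≡p = cong suc (trans (ℕ.+-comm c (suc m)) m+c+1≡q)
    p-divisible : 1 ≤v pℚ
    p-divisible = ≤v-/ (+ p) 0 p∤1 (∣-reflexive (ℕ.*-identityʳ p))
    X-divisible : 1 ≤v X
    X-divisible = ≤v-- (≤v-+ (H-shift c c<p) (H[p∸1]-divisible 2<p)) (reciprocal-pair c m c+m+2≡p)
    regroup : ∀ π a h hq ip ic im →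
      π Q.* (a Q.- (h Q.+ ic)) Q.- (π Q.* ip Q.+ π Q.* im) ≡
      π Q.* ((a Q.- (hq Q.+ ip) Q.- h) Q.+ hq Q.- (ic Q.+ im))
    regroup = solve-∀ ℚ-ring
    -- H p in X unfolds to H q + 1/p.
    expand : pℚ Q.* (H (p + c) Q.- H (suc c)) Q.- (1ℚ Q.+ + p / suc m) ≡ pℚ Q.* X
    expand = begin
      pℚ Q.* (H (p + c) Q.- H (suc c)) Q.- (1ℚ Q.+ + p / suc m)
        ≡⟨ cong₂ (λ u v → pℚ Q.* (H (p + c) Q.- H (suc c)) Q.- (u Q.+ v))
             (sym (trans (n/1*1/d≡n/d p q) (n/n≡1 q))) (sym (n/1*1/d≡n/d p m)) ⟩
      pℚ Q.* (H (p + c) Q.- H (suc c)) Q.- (pℚ Q.* (+ 1 / p) Q.+ pℚ Q.* (+ 1 / suc m))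
        ≡⟨ regroup pℚ (H (p + c)) (H c) (H q) (+ 1 / p) (+ 1 / suc c) (+ 1 / suc m) ⟩
      pℚ Q.* X ∎
      where open ≡-Reasoning

q∸m≡1+c : ∀ {q} m c → suc (m + c) ≡ q → q ∸ m ≡ suc c
q∸m≡1+c m c refl = trans (cong (_∸ m) (sym (ℕ.+-suc m c))) (ℕ.m+n∸m≡n m (suc c))

2q∸m≡1+q+c : ∀ {q} m c → suc (m + c) ≡ q → 2 * q ∸ m ≡ suc q + c
2q∸m≡1+q+c m c refl = trans (cong (_∸ m) (double m c)) (ℕ.m+n∸m≡n m _)
  where
  double : ∀ m c → 2 * suc (m + c) ≡ m + (suc (suc (m + c)) + c)
  double = solve-∀ ℕ-ring

lemma6 : (p n : ℕ) → Prime p → p ≢ 2 → 2 * n + 5 < p →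
    ((+ p / 1) Q.* (H (2 * (p ∸ 1) ∸ 2 * n) Q.- H (p ∸ 1 ∸ 2 * n)))
    ≡ (1ℚ Q.+ (+ p / suc (2 * n))) [mod p ^ 2 ]
lemma6 zero _ _ _ ()
lemma6 (suc q) n p-prime _ 2n+5<p =
  ≤v⇒∣↥ (subst₂ (λ a b → 2 ≤v (+ suc q / 1) Q.* (H a Q.- H b) Q.- (1ℚ Q.+ + suc q / suc (2 * n)))
           (sym (2q∸m≡1+q+c (2 * n) c 2n+1+c≡q)) (sym (q∸m≡1+c (2 * n) c 2n+1+c≡q))
           (harmonic-difference-congruence 2<p (2 * n) c 2n+1+c≡q))
  where
  open Valuation p-prime
  open Harmonic p-prime
  2<p : 2 < suc q
  2<p = ℕ.<-trans (ℕ.≤-trans (s≤s (s≤s (s≤s z≤n))) (ℕ.m≤n+m 5 (2 * n))) 2n+5<p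
  2n+1≤q : suc (2 * n) ≤ q
  2n+1≤q = ℕ.≤-trans (ℕ.m<m+n (2 * n) (s≤s z≤n)) (ℕ.≤-pred 2n+5<p)
  c : ℕ
  c = q ∸ suc (2 * n)
  2n+1+c≡q : suc (2 * n + c) ≡ q
  2n+1+c≡q = ℕ.m+[n∸m]≡n 2n+1≤q
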